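{- Let $A$ be a twisted polygon indexed either by $\mathbb{Z}$ or by $\frac12+\mathbb{Z}$, with no three consecutive points collinear (and with its $y$-parameters defined). Then for each index $i$ of $A$: (1) $A_{i-2},A_i,A_{i+2}$ are collinear if and only if $y_{2i}(A)=-1$; (2) the lines $\overleftrightarrow{A_{i-2}A_{i-1}},\overleftrightarrow{A_iA_{i+1}},\overleftrightarrow{A_{i+2}A_{i+3}}$ are concurrent if and only if $y_{2i+1}(A)=-1$.
   Context: A twisted polygon is a sequence $(A_i)$ of points in the real projective plane, indexed by $\mathbb{Z}$ or $\frac12+\mathbb{Z}$, with $A_{i+n}=\phi(A_i)$ for some $n$ and some projective transformation $\phi$. $\overleftrightarrow{PQ}$ denotes the line through $P,Q$. Cross ratio: $\chi(a,b,c,d)=\frac{(a-b)(c-d)}{(a-c)(b-d)}$ for four collinear points or four concurrent lines. For each index $k$: $y_{2k}(A)=-\big(\chi(\overleftrightarrow{A_kA_{k-2}},\overleftrightarrow{A_kA_{k-1}},\overleftrightarrow{A_kA_{k+1}},\overleftrightarrow{A_kA_{k+2}})\big)^{ -1}$ and $y_{2k+1}(A)=-\chi(\overleftrightarrow{A_{k-2}A_{k-1}}\cap L,A_k,A_{k+1},\overleftrightarrow{A_{k+2}A_{k+3}}\cap L)$ with $L=\overleftrightarrow{A_kA_{k+1}}$. -}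

module Defs where

open import Level using (Level; _⊔_)
open import Algebra.Bundles using (CommutativeRing)
open import Data.Fin using (Fin; zero; suc)
open import Data.Integer using (ℤ; +_) renaming (_+_ to _+ℤ_)
open import Data.Nat using (ℕ; suc)
open import Data.Product using (Σ; ∃; _×_; _,_)
open import Relation.Nullary using (¬_)

record Field (c ℓ : Level) : Set (Level.suc (c ⊔ ℓ)) where
  field
    commutativeRing : CommutativeRing c ℓ
  open CommutativeRing commutativeRing public
  field
    1≉0     : ¬ (1# ≈ 0#)
    inverse : ∀ x → ¬ (x ≈ 0#) → ∃ λ y → x * y ≈ 1#

module _ {c ℓ : Level} (F : Field c ℓ) where
  open Field F using (Carrier; _≈_; _+_; _*_; -_; _-_; 0#; 1#)

  -- A point of the projective plane KP² is represented by a
  -- nonzero vector (homogeneous coordinates); a line of KP² by a nonzero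
  -- vector of the dual space (a point P lies on the line ℓ iff ℓ · P = 0).
  V3 : Set c
  V3 = Fin 3 → Carrier

  mkV : Carrier → Carrier → Carrier → V3
  mkV a b d zero = a
  mkV a b d (suc zero) = b
  mkV a b d (suc (suc zero)) = d

  NonZero3 : V3 → Set ℓ
  NonZero3 v = ¬ ((i : Fin 3) → v i ≈ 0#)

  _⨯_ : V3 → V3 → V3
  u ⨯ v = mkV (u (suc zero) * v (suc (suc zero)) - u (suc (suc zero)) * v (suc zero))
              (u (suc (suc zero)) * v zero - u zero * v (suc (suc zero)))
              (u zero * v (suc zero) - u (suc zero) * v zero)

  _·_ : V3 → V3 → Carrier
  u · v = u zero * v zero + u (suc zero) * v (suc zero) + u (suc (suc zero)) * v (suc (suc zero))

  det : V3 → V3 → V3 → Carrier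
  det u v w = (u ⨯ v) · w

  lineThrough : V3 → V3 → V3
  lineThrough P Q = P ⨯ Q

  meet : V3 → V3 → V3
  meet l m = l ⨯ m

  Collinear : V3 → V3 → V3 → Set ℓ
  Collinear P Q R = det P Q R ≈ 0#

  Concurrent : V3 → V3 → V3 → Set ℓ
  Concurrent l m n = det l m n ≈ 0#

  Mat3 : Set c
  Mat3 = Fin 3 → V3

  _$_ : Mat3 → V3 → V3
  (M $ v) i = M i · v

  Invertible : Mat3 → Set (c ⊔ ℓ)
  Invertible M = ∃ λ N → (∀ v i → (N $ (M $ v)) i ≈ v i) × (∀ v i → (M $ (N $ v)) i ≈ v i)

  _∼_ : V3 → V3 → Set (c ⊔ ℓ)
  u ∼ v = ∃ λ λ' → ¬ (λ' ≈ 0#) × (∀ i → u i ≈ λ' * v i)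

  IsTwistedPolygon : (ℤ → V3) → Set (c ⊔ ℓ)
  IsTwistedPolygon A =
    ((i : ℤ) → NonZero3 (A i)) ×
    Σ ℕ λ n → Σ Mat3 λ M → Invertible M × ((i : ℤ) → A (i +ℤ + suc n) ∼ (M $ A i))

  NoThreeConsecutiveCollinear : (ℤ → V3) → Set ℓ
  NoThreeConsecutiveCollinear A = (i : ℤ) → ¬ Collinear (A i) (A (i +ℤ + 1)) (A (i +ℤ + 2))

  -- Cross ratio of four points on a common line (or four lines through a
  -- common point), given by homogeneous coordinate vectors lying in a common
  -- 2-dimensional subspace W of K³ (or of its dual).  For a, b ∈ W the cross
  -- product a × b equals [a b]·n for a fixed nonzero normal n of W, where
  -- [a b] = s_a t_b - t_a s_b in coordinates (s,t) on W, and the affine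
  -- difference of the corresponding points is proportional to [a b]
  -- (a − b = [b a]/(s_a s_b)).  Hence
  --   χ(a,b,c,d) = (a−b)(c−d)/((a−c)(b−d)) = [a b][c d]/([a c][b d]),
  -- which is encoded homogeneously (no choice of n or coordinate needed):
  -- χ(a,b,c,d) = r  iff the denominator is nonzero and
  --   (a×b)_i (c×d)_j = r (a×c)_i (b×d)_j  for all i, j.
  IsCrossRatio : V3 → V3 → V3 → V3 → Carrier → Set ℓ
  IsCrossRatio a b c d r =
    ¬ ((i j : Fin 3) → (a ⨯ c) i * (b ⨯ d) j ≈ 0#) ×
    ((i j : Fin 3) → (a ⨯ b) i * (c ⨯ d) j ≈ r * ((a ⨯ c) i * (b ⨯ d) j))

  -- y_{2k}(A) = y  (for the vertex A_k):
  --   y = -(χ(A_kA_{k-2}, A_kA_{k-1}, A_kA_{k+1}, A_kA_{k+2}))^{-1},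
  -- i.e. χ is defined, and y · χ = -1 (which forces χ ≠ 0).
  IsYVertex : (ℤ → V3) → ℤ → Carrier → Set (c ⊔ ℓ)
  IsYVertex A k y = ∃ λ χ →
    IsCrossRatio (lineThrough (A k) (A (k +ℤ Data.Integer.-[1+ 1 ]))) (lineThrough (A k) (A (k +ℤ Data.Integer.-[1+ 0 ])))
                 (lineThrough (A k) (A (k +ℤ + 1))) (lineThrough (A k) (A (k +ℤ + 2))) χ
    × (y * χ ≈ - 1#)

  IsYEdge : (ℤ → V3) → ℤ → Carrier → Set (c ⊔ ℓ)
  IsYEdge A k y = ∃ λ χ →
    IsCrossRatio (meet (lineThrough (A (k +ℤ Data.Integer.-[1+ 1 ])) (A (k +ℤ Data.Integer.-[1+ 0 ]))) L)
                 (A k) (A (k +ℤ + 1))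
                 (meet (lineThrough (A (k +ℤ + 2)) (A (k +ℤ + 3))) L) χ
    × (y ≈ - χ)
    where L = lineThrough (A k) (A (k +ℤ + 1))

  YParametersDefined : (ℤ → V3) → Set (c ⊔ ℓ)
  YParametersDefined A = (k : ℤ) → (∃ λ y → IsYVertex A k y) × (∃ λ y → IsYEdge A k y)

module Submission where

-- In homogeneous coordinates the lines through P are the vectors P ⨯ X, and two of them meet in
-- (P ⨯ X) ⨯ (P ⨯ Y) = [P X Y] P.  So every product in the cross-ratio equations of the pencil
-- P X₁, P X₂, P X₃, P X₄ is a multiple of P_i P_j, and the cross ratio is 1 exactly when
-- [P X₁ X₂][P X₃ X₄] = [P X₁ X₃][P X₂ X₄].  By the three-term Grassmann–Plücker relation the
-- difference of the two sides is -[X₁ P X₄][X₂ P X₃]; the second factor does not vanish because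
-- A_{i-1}, A_i, A_{i+1} are not collinear, so y_{2i} = -1 iff A_{i-2}, A_i, A_{i+2} are collinear.
-- Dually, for four points on L = P ⨯ Q, of which the outer two are l ⨯ L and m ⨯ L, all the joins
-- in the cross-ratio equations are multiples of L with coefficients l · P, m · Q, …, and the
-- Binet–Cauchy identity turns "cross ratio = 1" into [l L m] = 0, i.e. into concurrency of l, L, m.

open import Level using (Level)
open import Algebra.Bundles using (CommutativeRing)
import Algebra.Solver.Ring
import Algebra.Solver.Ring.AlmostCommutativeRing as ACR
open import Data.Fin using (Fin; zero; suc; #_; _↑ˡ_; _↑ʳ_)
open import Data.Integer as ℤ using (ℤ; +_; -[1+_]; _⊖_)
import Data.Integer.Properties as ℤ
open import Data.Maybe using (Maybe; just; nothing)
open import Data.Nat as ℕ using (ℕ)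
import Data.Nat.Properties as ℕ
open import Data.Product using (_×_; _,_; ∃)
open import Data.Sign as Sign using ()
open import Data.Vec using (Vec; []; _∷_)
open import Function.Bundles using (_⇔_; mk⇔; module Equivalence)
open import Function.Construct.Symmetry using (⇔-sym)
open import Function.Related.Propositional using (module EquationalReasoning)
open import Relation.Binary.PropositionalEquality as ≡ using (_≡_)
import Relation.Binary.Reasoning.Setoid
open import Relation.Nullary using (¬_; yes; no)

open import Defs hiding (_⨯_; _·_; det)

-- The ring solver decides an identity by computing normal forms, so its coefficients must live in
-- a ring whose arithmetic evaluates: the integers, mapped into R by n ↦ n × 1#.
module IntegerCoefficients {c ℓ : Level} (R : CommutativeRing c ℓ) where
  open CommutativeRing R
  open import Algebra.Properties.Ring ring using (-0#≈0#; -‿involutive; -‿distribˡ-*; -‿distribʳ-*)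
  open import Algebra.Properties.AbelianGroup +-abelianGroup using (⁻¹-∙-comm)
  open import Algebra.Properties.Semiring.Mult.TCOptimised semiring using (1+×; ×-homo-+; ×1-homo-*)
    renaming (_×_ to _×′_)
  open import Relation.Binary.Reasoning.Setoid setoid

  ⟦_⟧ : ℤ → Carrier
  ⟦ + n ⟧ = n ×′ 1#
  ⟦ -[1+ n ] ⟧ = - (ℕ.suc n ×′ 1#)

  1+a-[1+b]≈a-b : ∀ a b → (1# + a) - (1# + b) ≈ a - b
  1+a-[1+b]≈a-b a b = begin
    (1# + a) + - (1# + b)    ≈⟨ +-cong (+-comm a 1#) (⁻¹-∙-comm 1# b) ⟨
    (a + 1#) + (- 1# + - b)  ≈⟨ +-assoc a 1# _ ⟩
    a + (1# + (- 1# + - b))  ≈⟨ +-congˡ (+-assoc 1# (- 1#) (- b)) ⟨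
    a + ((1# + - 1#) + - b)  ≈⟨ +-congˡ (+-congʳ (-‿inverseʳ 1#)) ⟩
    a + (0# + - b)           ≈⟨ +-congˡ (+-identityˡ (- b)) ⟩
    a - b                    ∎

  ⊖-homo : ∀ m n → ⟦ m ⊖ n ⟧ ≈ m ×′ 1# - n ×′ 1#
  ⊖-homo ℕ.zero ℕ.zero = sym (-‿inverseʳ 0#)
  ⊖-homo ℕ.zero (ℕ.suc n) = sym (+-identityˡ _)
  ⊖-homo (ℕ.suc m) ℕ.zero = sym (trans (+-congˡ -0#≈0#) (+-identityʳ _))
  ⊖-homo (ℕ.suc m) (ℕ.suc n) rewrite ℤ.[1+m]⊖[1+n]≡m⊖n m n = begin
    ⟦ m ⊖ n ⟧                        ≈⟨ ⊖-homo m n ⟩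
    m ×′ 1# - n ×′ 1#                ≈⟨ 1+a-[1+b]≈a-b _ _ ⟨
    (1# + m ×′ 1#) - (1# + n ×′ 1#)  ≈⟨ +-cong (1+× m 1#) (-‿cong (1+× n 1#)) ⟨
    ℕ.suc m ×′ 1# - ℕ.suc n ×′ 1#    ∎

  +-homo : ∀ x y → ⟦ x ℤ.+ y ⟧ ≈ ⟦ x ⟧ + ⟦ y ⟧
  +-homo (+ m) (+ n) = ×-homo-+ 1# m n
  +-homo (+ m) -[1+ n ] = ⊖-homo m (ℕ.suc n)
  +-homo -[1+ m ] (+ n) = trans (⊖-homo n (ℕ.suc m)) (+-comm _ _)
  +-homo -[1+ m ] -[1+ n ] = begin
    - (ℕ.suc (ℕ.suc (m ℕ.+ n)) ×′ 1#)      ≡⟨ ≡.cong (λ k → - (ℕ.suc k ×′ 1#)) (ℕ.+-suc m n) ⟨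
    - ((ℕ.suc m ℕ.+ ℕ.suc n) ×′ 1#)        ≈⟨ -‿cong (×-homo-+ 1# (ℕ.suc m) (ℕ.suc n)) ⟩
    - (ℕ.suc m ×′ 1# + ℕ.suc n ×′ 1#)      ≈⟨ ⁻¹-∙-comm _ _ ⟨
    - (ℕ.suc m ×′ 1#) + - (ℕ.suc n ×′ 1#)  ∎

  +◃-homo : ∀ n → ⟦ Sign.+ ℤ.◃ n ⟧ ≈ n ×′ 1#
  +◃-homo ℕ.zero = refl
  +◃-homo (ℕ.suc n) = refl

  -◃-homo : ∀ n → ⟦ Sign.- ℤ.◃ n ⟧ ≈ - (n ×′ 1#)
  -◃-homo ℕ.zero = sym -0#≈0#
  -◃-homo (ℕ.suc n) = refl

  *-homo : ∀ x y → ⟦ x ℤ.* y ⟧ ≈ ⟦ x ⟧ * ⟦ y ⟧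
  *-homo (+ m) (+ n) = trans (+◃-homo (m ℕ.* n)) (×1-homo-* m n)
  *-homo (+ ℕ.zero) -[1+ n ] = sym (zeroˡ _)
  *-homo (+ ℕ.suc m) -[1+ n ] =
    trans (-◃-homo (ℕ.suc m ℕ.* ℕ.suc n)) (trans (-‿cong (×1-homo-* (ℕ.suc m) (ℕ.suc n))) (-‿distribʳ-* _ _))
  *-homo -[1+ m ] (+ ℕ.zero) rewrite ℕ.*-zeroʳ m = sym (zeroʳ _)
  *-homo -[1+ m ] (+ ℕ.suc n) =
    trans (-◃-homo (ℕ.suc m ℕ.* ℕ.suc n)) (trans (-‿cong (×1-homo-* (ℕ.suc m) (ℕ.suc n))) (-‿distribˡ-* _ _))
  *-homo -[1+ m ] -[1+ n ] = begin
    ⟦ + (ℕ.suc m ℕ.* ℕ.suc n) ⟧            ≈⟨ ×1-homo-* (ℕ.suc m) (ℕ.suc n) ⟩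
    ℕ.suc m ×′ 1# * ℕ.suc n ×′ 1#          ≈⟨ -‿involutive _ ⟨
    - - (ℕ.suc m ×′ 1# * ℕ.suc n ×′ 1#)    ≈⟨ -‿cong (-‿distribˡ-* _ _) ⟩
    - (- (ℕ.suc m ×′ 1#) * ℕ.suc n ×′ 1#)  ≈⟨ -‿distribʳ-* _ _ ⟩
    - (ℕ.suc m ×′ 1#) * - (ℕ.suc n ×′ 1#)  ∎

  -‿homo : ∀ x → ⟦ ℤ.- x ⟧ ≈ - ⟦ x ⟧
  -‿homo (+ ℕ.zero) = sym -0#≈0#
  -‿homo (+ ℕ.suc n) = refl
  -‿homo -[1+ n ] = sym (-‿involutive _)

  morphism : ℤ.+-*-rawRing ACR.-Raw-AlmostCommutative⟶ ACR.fromCommutativeRing R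
  morphism = record
    { ⟦_⟧ = ⟦_⟧ ; +-homo = +-homo ; *-homo = *-homo ; -‿homo = -‿homo ; 0-homo = refl ; 1-homo = refl }

  _≟_ : ∀ x y → Maybe (⟦ x ⟧ ≈ ⟦ y ⟧)
  x ≟ y with x ℤ.≟ y
  ... | yes x≡y = just (reflexive (≡.cong ⟦_⟧ x≡y))
  ... | no _ = nothing

module RingSolver {c ℓ : Level} (R : CommutativeRing c ℓ) =
  Algebra.Solver.Ring ℤ.+-*-rawRing (ACR.fromCommutativeRing R) (IntegerCoefficients.morphism R)
    (IntegerCoefficients._≟_ R)

-- Symbolic copies of the coordinate formulas of Defs, clause by clause: evaluating a symbolic
-- identity at the coordinates of concrete vectors gives the Defs expressions on the nose.
module VectorIdentities {c ℓ : Level} (R : CommutativeRing c ℓ) where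
  open CommutativeRing R using (Carrier; _≈_)
  open RingSolver R using (Polynomial; var; _:+_; _:*_; _:-_; ⟦_⟧; ⟦_⟧↓; prove)

  SymbolicV3 : ℕ → Set
  SymbolicV3 n = Fin 3 → Polynomial n

  module _ {n : ℕ} where
    infixl 8 _⨯ₛ_
    infix 7 _·ₛ_

    _⨯ₛ_ : SymbolicV3 n → SymbolicV3 n → SymbolicV3 n
    (u ⨯ₛ v) zero = u (suc zero) :* v (suc (suc zero)) :- u (suc (suc zero)) :* v (suc zero)
    (u ⨯ₛ v) (suc zero) = u (suc (suc zero)) :* v zero :- u zero :* v (suc (suc zero))
    (u ⨯ₛ v) (suc (suc zero)) = u zero :* v (suc zero) :- u (suc zero) :* v zero

    _·ₛ_ : SymbolicV3 n → SymbolicV3 n → Polynomial n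
    u ·ₛ v = u zero :* v zero :+ u (suc zero) :* v (suc zero) :+ u (suc (suc zero)) :* v (suc (suc zero))

    detₛ : SymbolicV3 n → SymbolicV3 n → SymbolicV3 n → Polynomial n
    detₛ u v w = u ⨯ₛ v ·ₛ w

  coords : ∀ {m} → Vec (Fin 3 → Carrier) m → Vec Carrier (m ℕ.* 3)
  coords [] = []
  coords (P ∷ Ps) = P zero ∷ P (suc zero) ∷ P (suc (suc zero)) ∷ coords Ps

  coordinate : ∀ {m} → Fin m → Fin 3 → Fin (m ℕ.* 3)
  coordinate {ℕ.suc m} zero k = k ↑ˡ (m ℕ.* 3)
  coordinate {ℕ.suc m} (suc j) k = 3 ↑ʳ coordinate j k

  point : ∀ {m} → Fin m → SymbolicV3 (m ℕ.* 3)
  point j k = var (coordinate j k)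

  prove₃ : ∀ {n} (ρ : Vec Carrier n) (u v : SymbolicV3 n) →
           ⟦ u zero ⟧↓ ρ ≈ ⟦ v zero ⟧↓ ρ → ⟦ u (suc zero) ⟧↓ ρ ≈ ⟦ v (suc zero) ⟧↓ ρ →
           ⟦ u (suc (suc zero)) ⟧↓ ρ ≈ ⟦ v (suc (suc zero)) ⟧↓ ρ →
           ⟦ u zero ⟧ ρ ≈ ⟦ v zero ⟧ ρ × ⟦ u (suc zero) ⟧ ρ ≈ ⟦ v (suc zero) ⟧ ρ ×
           ⟦ u (suc (suc zero)) ⟧ ρ ≈ ⟦ v (suc (suc zero)) ⟧ ρ
  prove₃ ρ u v e₀ e₁ e₂ = prove ρ (u zero) (v zero) e₀ , prove ρ (u (suc zero)) (v (suc zero)) e₁ ,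
                          prove ρ (u (suc (suc zero))) (v (suc (suc zero))) e₂

  coordinatewise : {u v : Fin 3 → Carrier} →
                   u zero ≈ v zero × u (suc zero) ≈ v (suc zero) × u (suc (suc zero)) ≈ v (suc (suc zero)) →
                   ∀ k → u k ≈ v k
  coordinatewise (e₀ , e₁ , e₂) zero = e₀
  coordinatewise (e₀ , e₁ , e₂) (suc zero) = e₁
  coordinatewise (e₀ , e₁ , e₂) (suc (suc zero)) = e₂

module Geometry {c ℓ : Level} (F : Field c ℓ) where
  open Field F hiding (zero)
  open import Algebra.Properties.Ring ring using (-0#≈0#; -‿involutive; -1*x≈-x)
  open import Algebra.Properties.Group +-group using (x∙y⁻¹≈ε⇒x≈y; x≈y⇒x∙y⁻¹≈ε; ⁻¹-injective)
  open import Algebra.Properties.CommutativeSemigroup *-commutativeSemigroup using (xy∙z≈xz∙y)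
  open RingSolver commutativeRing using (_:+_; _:*_; _:-_; :-_; prove; solve; _:=_)
  open VectorIdentities commutativeRing
  module ≈-Reasoning = Relation.Binary.Reasoning.Setoid setoid

  infixl 8 _⨯_
  infix 7 _·_

  _⨯_ : V3 F → V3 F → V3 F
  _⨯_ = Defs._⨯_ F

  _·_ : V3 F → V3 F → Carrier
  _·_ = Defs._·_ F

  det : V3 F → V3 F → V3 F → Carrier
  det = Defs.det F

  x*y≈0⇒x≈0 : ∀ {x y} → ¬ y ≈ 0# → x * y ≈ 0# → x ≈ 0#
  x*y≈0⇒x≈0 {x} {y} y≉0 xy≈0 with inverse y y≉0
  ... | y⁻¹ , yy⁻¹≈1 = let open ≈-Reasoning in begin
    x              ≈⟨ *-identityʳ x ⟨
    x * 1#         ≈⟨ *-congˡ yy⁻¹≈1 ⟨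
    x * (y * y⁻¹)  ≈⟨ *-assoc x y y⁻¹ ⟨
    x * y * y⁻¹    ≈⟨ *-congʳ xy≈0 ⟩
    0# * y⁻¹       ≈⟨ zeroˡ y⁻¹ ⟩
    0#             ∎

  x*y≈0⇔x≈0 : ∀ {x y} → ¬ y ≈ 0# → x * y ≈ 0# ⇔ x ≈ 0#
  x*y≈0⇔x≈0 {y = y} y≉0 = mk⇔ (x*y≈0⇒x≈0 y≉0) (λ x≈0 → trans (*-congʳ x≈0) (zeroˡ y))

  -x≈0⇔x≈0 : ∀ {x} → - x ≈ 0# ⇔ x ≈ 0#
  -x≈0⇔x≈0 {x} = mk⇔ (λ -x≈0 → trans (sym (-‿involutive x)) (-0≈0 -x≈0)) -0≈0
    where
    -0≈0 : ∀ {y} → y ≈ 0# → - y ≈ 0#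
    -0≈0 y≈0 = trans (-‿cong y≈0) -0#≈0#

  x-y≈z⇒[x≈y⇔z≈0] : ∀ {x y z} → x - y ≈ z → x ≈ y ⇔ z ≈ 0#
  x-y≈z⇒[x≈y⇔z≈0] {x} {y} x-y≈z =
    mk⇔ (λ x≈y → trans (sym x-y≈z) (x≈y⇒x∙y⁻¹≈ε x≈y)) (λ z≈0 → x∙y⁻¹≈ε⇒x≈y x y (trans x-y≈z z≈0))

  -1*x≈-1⇔x≈1 : ∀ {x} → - 1# * x ≈ - 1# ⇔ x ≈ 1#
  -1*x≈-1⇔x≈1 {x} = mk⇔ (λ h → ⁻¹-injective (trans (sym (-1*x≈-x x)) h)) (λ x≈1 → trans (-1*x≈-x x) (-‿cong x≈1))

  -1≈-x⇔x≈1 : ∀ {x} → - 1# ≈ - x ⇔ x ≈ 1#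
  -1≈-x⇔x≈1 = mk⇔ (λ h → sym (⁻¹-injective h)) (λ x≈1 → -‿cong (sym x≈1))

  meet-lines-through : ∀ P X Y k → ((P ⨯ X) ⨯ (P ⨯ Y)) k ≈ det P X Y * P k
  meet-lines-through P X Y = coordinatewise
    (prove₃ (coords (P ∷ X ∷ Y ∷ [])) ((p ⨯ₛ x) ⨯ₛ (p ⨯ₛ y)) (λ k → detₛ p x y :* p k) refl refl refl)
    where
    p x y : SymbolicV3 9
    p = point {3} (# 0); x = point {3} (# 1); y = point {3} (# 2)

  meet-⨯-first : ∀ m P Q k → ((m ⨯ (P ⨯ Q)) ⨯ P) k ≈ (m · P) * (P ⨯ Q) k
  meet-⨯-first m P Q = coordinatewise
    (prove₃ (coords (m ∷ P ∷ Q ∷ [])) ((mₛ ⨯ₛ (p ⨯ₛ q)) ⨯ₛ p) (λ k → (mₛ ·ₛ p) :* (p ⨯ₛ q) k) refl refl refl)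
    where
    mₛ p q : SymbolicV3 9
    mₛ = point {3} (# 0); p = point {3} (# 1); q = point {3} (# 2)

  meet-⨯-second : ∀ m P Q k → ((m ⨯ (P ⨯ Q)) ⨯ Q) k ≈ (m · Q) * (P ⨯ Q) k
  meet-⨯-second m P Q = coordinatewise
    (prove₃ (coords (m ∷ P ∷ Q ∷ [])) ((mₛ ⨯ₛ (p ⨯ₛ q)) ⨯ₛ q) (λ k → (mₛ ·ₛ q) :* (p ⨯ₛ q) k) refl refl refl)
    where
    mₛ p q : SymbolicV3 9
    mₛ = point {3} (# 0); p = point {3} (# 1); q = point {3} (# 2)

  first-⨯-meet : ∀ m P Q k → (P ⨯ (m ⨯ (P ⨯ Q))) k ≈ - (m · P) * (P ⨯ Q) k
  first-⨯-meet m P Q = coordinatewise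
    (prove₃ (coords (m ∷ P ∷ Q ∷ [])) (p ⨯ₛ (mₛ ⨯ₛ (p ⨯ₛ q))) (λ k → :- (mₛ ·ₛ p) :* (p ⨯ₛ q) k) refl refl refl)
    where
    mₛ p q : SymbolicV3 9
    mₛ = point {3} (# 0); p = point {3} (# 1); q = point {3} (# 2)

  second-⨯-meet : ∀ m P Q k → (Q ⨯ (m ⨯ (P ⨯ Q))) k ≈ - (m · Q) * (P ⨯ Q) k
  second-⨯-meet m P Q = coordinatewise
    (prove₃ (coords (m ∷ P ∷ Q ∷ [])) (q ⨯ₛ (mₛ ⨯ₛ (p ⨯ₛ q))) (λ k → :- (mₛ ·ₛ q) :* (p ⨯ₛ q) k) refl refl refl)
    where
    mₛ p q : SymbolicV3 9
    mₛ = point {3} (# 0); p = point {3} (# 1); q = point {3} (# 2)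

  ·⨯≈det : ∀ P Q R → P · (Q ⨯ R) ≈ det R P Q
  ·⨯≈det P Q R = prove (coords (P ∷ Q ∷ R ∷ [])) (p ·ₛ (q ⨯ₛ r)) (detₛ r p q) refl
    where
    p q r : SymbolicV3 9
    p = point {3} (# 0); q = point {3} (# 1); r = point {3} (# 2)

  grassmann-plücker : ∀ P X Y Z W →
    det P X Y * det P Z W - det P X Z * det P Y W ≈ - (det X P W * det Y P Z)
  grassmann-plücker P X Y Z W = prove (coords (P ∷ X ∷ Y ∷ Z ∷ W ∷ []))
    (detₛ p x y :* detₛ p z w :- detₛ p x z :* detₛ p y w) (:- (detₛ x p w :* detₛ y p z)) refl
    where
    p x y z w : SymbolicV3 15
    p = point {5} (# 0); x = point {5} (# 1); y = point {5} (# 2); z = point {5} (# 3); w = point {5} (# 4)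

  binet-cauchy : ∀ l m P Q → (l · P) * - (m · Q) - (l · Q) * - (m · P) ≈ det l (P ⨯ Q) m
  binet-cauchy l m P Q = prove (coords (l ∷ m ∷ P ∷ Q ∷ []))
    ((lₛ ·ₛ p) :* :- (mₛ ·ₛ q) :- (lₛ ·ₛ q) :* :- (mₛ ·ₛ p)) (detₛ lₛ (p ⨯ₛ q) mₛ) refl
    where
    lₛ mₛ p q : SymbolicV3 12
    lₛ = point {4} (# 0); mₛ = point {4} (# 1); p = point {4} (# 2); q = point {4} (# 3)

  s*u≈0⇒s*[u·v]≈0 : ∀ {s} u v → (∀ k → s * u k ≈ 0#) → s * (u · v) ≈ 0#
  s*u≈0⇒s*[u·v]≈0 {s} u v su≈0 = begin
    s * (u · v)
      ≈⟨ solve 7 (λ s u₀ u₁ u₂ v₀ v₁ v₂ → s :* (u₀ :* v₀ :+ u₁ :* v₁ :+ u₂ :* v₂)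
                    := s :* u₀ :* v₀ :+ s :* u₁ :* v₁ :+ s :* u₂ :* v₂)
                 refl s (u zero) (u (suc zero)) (u (suc (suc zero))) (v zero) (v (suc zero)) (v (suc (suc zero))) ⟩
    s * u zero * v zero + s * u (suc zero) * v (suc zero) + s * u (suc (suc zero)) * v (suc (suc zero))
      ≈⟨ +-cong (+-cong (vanishes zero) (vanishes (suc zero))) (vanishes (suc (suc zero))) ⟩
    0# + 0# + 0#
      ≈⟨ trans (+-identityʳ _) (+-identityʳ _) ⟩
    0# ∎
    where
    open ≈-Reasoning
    vanishes : ∀ k → s * u k * v k ≈ 0#
    vanishes k = trans (*-congʳ (su≈0 k)) (zeroˡ (v k))

  -- Q · v ≉ 0 is used instead of Q ≉ 0, which is a negated universal and would only give ¬ ¬ s ≈ 0.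
  s*QᵢQⱼ≈0⇒s≈0 : ∀ {s} Q v → ¬ Q · v ≈ 0# → (∀ i j → s * Q i * Q j ≈ 0#) → s ≈ 0#
  s*QᵢQⱼ≈0⇒s≈0 {s} Q v Q·v≉0 sQQ≈0 =
    x*y≈0⇒x≈0 Q·v≉0 (x*y≈0⇒x≈0 Q·v≉0 (s*u≈0⇒s*[u·v]≈0 Q v λ i →
      trans (xy∙z≈xz∙y s (Q · v) (Q i)) (s*u≈0⇒s*[u·v]≈0 Q v (sQQ≈0 i))))

  module CrossRatioOfProportional
    (a b c d Q v : V3 F) (Q·v≉0 : ¬ Q · v ≈ 0#) {x y z w : Carrier}
    (ab≈xQ : ∀ k → (a ⨯ b) k ≈ x * Q k) (cd≈yQ : ∀ k → (c ⨯ d) k ≈ y * Q k)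
    (ac≈zQ : ∀ k → (a ⨯ c) k ≈ z * Q k) (bd≈wQ : ∀ k → (b ⨯ d) k ≈ w * Q k)
    where

    products-difference : ∀ r i j →
      (a ⨯ b) i * (c ⨯ d) j - r * ((a ⨯ c) i * (b ⨯ d) j) ≈ (x * y - r * (z * w)) * Q i * Q j
    products-difference r i j = begin
      (a ⨯ b) i * (c ⨯ d) j - r * ((a ⨯ c) i * (b ⨯ d) j)
        ≈⟨ +-cong (*-cong (ab≈xQ i) (cd≈yQ j)) (-‿cong (*-congˡ (*-cong (ac≈zQ i) (bd≈wQ j)))) ⟩
      x * Q i * (y * Q j) - r * (z * Q i * (w * Q j))
        ≈⟨ solve 7 (λ x y z w r qᵢ qⱼ → x :* qᵢ :* (y :* qⱼ) :- r :* (z :* qᵢ :* (w :* qⱼ))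
                      := (x :* y :- r :* (z :* w)) :* qᵢ :* qⱼ) refl x y z w r (Q i) (Q j) ⟩
      (x * y - r * (z * w)) * Q i * Q j ∎
      where open ≈-Reasoning

    equations⇔ : ∀ r → (∀ i j → (a ⨯ b) i * (c ⨯ d) j ≈ r * ((a ⨯ c) i * (b ⨯ d) j)) ⇔ x * y ≈ r * (z * w)
    equations⇔ r = mk⇔
      (λ eqs → from S≈0 (s*QᵢQⱼ≈0⇒s≈0 Q v Q·v≉0 λ i j → to (entry≈0 i j) (eqs i j)))
      (λ xy≈rzw i j → from (entry≈0 i j) (trans (*-congʳ (*-congʳ (to S≈0 xy≈rzw))) (trans (*-congʳ (zeroˡ _)) (zeroˡ _))))
      where
      open Equivalence
      S≈0 : x * y ≈ r * (z * w) ⇔ x * y - r * (z * w) ≈ 0#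
      S≈0 = x-y≈z⇒[x≈y⇔z≈0] refl
      entry≈0 : ∀ i j → (a ⨯ b) i * (c ⨯ d) j ≈ r * ((a ⨯ c) i * (b ⨯ d) j) ⇔ (x * y - r * (z * w)) * Q i * Q j ≈ 0#
      entry≈0 i j = x-y≈z⇒[x≈y⇔z≈0] (products-difference r i j)

    crossRatio-one⇔ : ∀ {r₀} {p : Carrier → Set ℓ} → IsCrossRatio F a b c d r₀ → (∀ χ → p χ ⇔ χ ≈ 1#) →
                      (∃ λ χ → IsCrossRatio F a b c d χ × p χ) ⇔ x * y ≈ z * w
    crossRatio-one⇔ (nondegenerate , _) p⇔χ≈1 = mk⇔
      (λ (χ , (_ , eqs) , pχ) → trans (to (equations⇔ χ) eqs) (trans (*-congʳ (to (p⇔χ≈1 χ) pχ)) (*-identityˡ _)))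
      (λ xy≈zw → 1# , (nondegenerate , from (equations⇔ 1#) (trans xy≈zw (sym (*-identityˡ _)))) , from (p⇔χ≈1 1#) refl)
      where open Equivalence

  collinear⇔cross-ratio-of-pencil≈1 : ∀ P X₁ X₂ X₃ X₄ {r₀} → ¬ Collinear F X₂ P X₃ →
    IsCrossRatio F (lineThrough F P X₁) (lineThrough F P X₂) (lineThrough F P X₃) (lineThrough F P X₄) r₀ →
    Collinear F X₁ P X₄ ⇔
      (∃ λ χ → IsCrossRatio F (lineThrough F P X₁) (lineThrough F P X₂) (lineThrough F P X₃) (lineThrough F P X₄) χ
             × - 1# * χ ≈ - 1#)
  collinear⇔cross-ratio-of-pencil≈1 P X₁ X₂ X₃ X₄ X₂PX₃≉0 isCrossRatio = ⇔-sym (begin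
    _                                                     ∼⟨ crossRatio-one⇔ isCrossRatio (λ _ → -1*x≈-1⇔x≈1) ⟩
    det P X₁ X₂ * det P X₃ X₄ ≈ det P X₁ X₃ * det P X₂ X₄  ∼⟨ x-y≈z⇒[x≈y⇔z≈0] (grassmann-plücker P X₁ X₂ X₃ X₄) ⟩
    - (det X₁ P X₄ * det X₂ P X₃) ≈ 0#                    ∼⟨ -x≈0⇔x≈0 ⟩
    det X₁ P X₄ * det X₂ P X₃ ≈ 0#                        ∼⟨ x*y≈0⇔x≈0 X₂PX₃≉0 ⟩
    det X₁ P X₄ ≈ 0#                                      ∎)
    where
    open EquationalReasoning
    open CrossRatioOfProportional (P ⨯ X₁) (P ⨯ X₂) (P ⨯ X₃) (P ⨯ X₄) P (X₃ ⨯ X₂)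
      (λ P·[X₃⨯X₂]≈0 → X₂PX₃≉0 (trans (sym (·⨯≈det P X₃ X₂)) P·[X₃⨯X₂]≈0))
      (meet-lines-through P X₁ X₂) (meet-lines-through P X₃ X₄) (meet-lines-through P X₁ X₃) (meet-lines-through P X₂ X₄)

  concurrent⇔cross-ratio-on-line≈1 : ∀ l m P Q R {r₀} → ¬ Collinear F P Q R →
    IsCrossRatio F (meet F l (lineThrough F P Q)) P Q (meet F m (lineThrough F P Q)) r₀ →
    Concurrent F l (lineThrough F P Q) m ⇔
      (∃ λ χ → IsCrossRatio F (meet F l (lineThrough F P Q)) P Q (meet F m (lineThrough F P Q)) χ × - 1# ≈ - χ)
  concurrent⇔cross-ratio-on-line≈1 l m P Q R PQR≉0 isCrossRatio = ⇔-sym (begin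
    _                                          ∼⟨ crossRatio-one⇔ isCrossRatio (λ _ → -1≈-x⇔x≈1) ⟩
    (l · P) * - (m · Q) ≈ (l · Q) * - (m · P)  ∼⟨ x-y≈z⇒[x≈y⇔z≈0] (binet-cauchy l m P Q) ⟩
    det l (P ⨯ Q) m ≈ 0#                       ∎)
    where
    open EquationalReasoning
    open CrossRatioOfProportional (l ⨯ (P ⨯ Q)) P Q (m ⨯ (P ⨯ Q)) (P ⨯ Q) R PQR≉0
      (meet-⨯-first l P Q) (second-⨯-meet m P Q) (meet-⨯-second l P Q) (first-⨯-meet m P Q)

open import Data.Integer using (_+_)
open Geometry using (collinear⇔cross-ratio-of-pencil≈1; concurrent⇔cross-ratio-on-line≈1)

¬collinear-around : ∀ {c ℓ} (F : Field c ℓ) (A : ℤ → V3 F) → NoThreeConsecutiveCollinear F A →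
  ∀ i → ¬ Collinear F (A (i + -[1+ 0 ])) (A i) (A (i + + 1))
¬collinear-around F A noneCollinear i =
  ≡.subst₂ (λ j k → ¬ Collinear F (A (i + -[1+ 0 ])) (A j) (A k))
    i-1+1≡i (ℤ.+-assoc i -[1+ 0 ] (+ 2)) (noneCollinear (i + -[1+ 0 ]))
  where
  i-1+1≡i : i + -[1+ 0 ] + + 1 ≡ i
  i-1+1≡i = ≡.trans (ℤ.+-assoc i -[1+ 0 ] (+ 1)) (ℤ.+-identityʳ i)

lemma7p2 : {c ℓ : Level} (F : Field c ℓ) (A : ℤ → V3 F) →
    IsTwistedPolygon F A → NoThreeConsecutiveCollinear F A → YParametersDefined F A →
    (i : ℤ) →
      (Collinear F (A (i + -[1+ 1 ])) (A i) (A (i + + 2)) ⇔ IsYVertex F A i (Field.-_ F (Field.1# F)))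
      × (Concurrent F (lineThrough F (A (i + -[1+ 1 ])) (A (i + -[1+ 0 ])))
                      (lineThrough F (A i) (A (i + + 1)))
                      (lineThrough F (A (i + + 2)) (A (i + + 3)))
         ⇔ IsYEdge F A i (Field.-_ F (Field.1# F)))
lemma7p2 F A _ noneCollinear yDefined i =
  let (_ , _ , vertexCrossRatio , _) , (_ , _ , edgeCrossRatio , _) = yDefined i in
  collinear⇔cross-ratio-of-pencil≈1 F A₀ A₋₂ A₋₁ A₁ A₂ (¬collinear-around F A noneCollinear i) vertexCrossRatio ,
  concurrent⇔cross-ratio-on-line≈1 F (lineThrough F A₋₂ A₋₁) (lineThrough F A₂ A₃) A₀ A₁ A₂
    (noneCollinear i) edgeCrossRatio
  where
  A₋₂ = A (i + -[1+ 1 ]); A₋₁ = A (i + -[1+ 0 ]); A₀ = A i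
  A₁ = A (i + + 1); A₂ = A (i + + 2); A₃ = A (i + + 3)
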